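{- Let $q$ be a power of an odd prime, $c\in\mathbb{F}_q^*$ and $f:\mathbb{F}_{q^2}\to\mathbb{F}_{q^2}$, $f(X)=c(X^{q+1}-X^2)$. Then $f$ has exactly $\frac{q-1}{2}$ cycles of length two.
   Context: A cycle of length $n$ is the orbit $\{\alpha,f(\alpha),\dots,f^{(n-1)}(\alpha)\}$ of a point $\alpha\in\mathbb{F}_{q^2}$ with $f^{(n)}(\alpha)=\alpha$ and $n\ge1$ minimal, where $f^{(n)}$ denotes the $n$-th iterate. -}

module Defs where

open import Level using (Level; _⊔_) renaming (suc to lsuc)
open import Algebra.Bundles using (CommutativeRing)
open import Data.Nat using (ℕ; zero; suc; _<_; _<?_)
open import Data.Fin using (Fin; toℕ)
open import Data.Fin.Properties using () renaming (_≟_ to _≟ᶠ_)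
open import Data.List using (List; length; filter)
open import Data.Fin.Base using ()
open import Data.List.Base using ()
open import Data.Product using (Σ; _×_; _,_; proj₁; proj₂)
open import Relation.Nullary using (¬_; Dec; yes; no)
open import Relation.Nullary.Decidable using (_×-dec_; ¬?; map′)
open import Relation.Binary.PropositionalEquality using (_≡_; cong)
import Data.List.Base as L
import Data.Fin.Base as F

record FiniteField (c ℓ : Level) : Set (lsuc (c ⊔ ℓ)) where
  field
    commRing : CommutativeRing c ℓ
  open CommutativeRing commRing public
  field
    1≉0      : ¬ (1# ≈ 0#)
    inverse  : ∀ x → ¬ (x ≈ 0#) → Σ Carrier (λ y → x * y ≈ 1#)
    size     : ℕ
    enum     : Fin size → Carrier
    index    : Carrier → Fin size
    enum-index : ∀ x → enum (index x) ≈ x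
    index-enum : ∀ i → index (enum i) ≡ i
    index-cong : ∀ {x y} → x ≈ y → index x ≡ index y

  infixr 8 _^_
  _^_ : Carrier → ℕ → Carrier
  x ^ zero  = 1#
  x ^ suc n = x * (x ^ n)

  _≈?_ : ∀ x y → Dec (x ≈ y)
  x ≈? y = map′ to from (index x ≟ᶠ index y)
    where
    to : index x ≡ index y → x ≈ y
    to e = trans (sym (enum-index x))
                 (trans (reflexive (cong enum e)) (enum-index y))
    from : x ≈ y → index x ≡ index y
    from = index-cong

module _ {c ℓ} (F : FiniteField c ℓ) where
  open FiniteField F

  -- The element enum i is the chosen representative of a cycle of length
  -- two of g: g (g a) ≈ a, g a ≉ a, and a is the one of the two points
  -- {a, g a} with the smaller index in the enumeration.  Each cycle of
  -- length two is thereby counted exactly once.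
  IsTwoCycleRep : (Carrier → Carrier) → Fin size → Set ℓ
  IsTwoCycleRep g i =
    (g (g (enum i)) ≈ enum i) × (¬ (g (enum i) ≈ enum i))
      × Lift′ (toℕ i < toℕ (index (g (enum i))))
    where
    Lift′ : Set → Set ℓ
    Lift′ A = Level.Lift ℓ A

  isTwoCycleRep? : (g : Carrier → Carrier) → ∀ i → Dec (IsTwoCycleRep g i)
  isTwoCycleRep? g i =
    (g (g (enum i)) ≈? enum i) ×-dec (¬? (g (enum i) ≈? enum i))
      ×-dec map′ Level.lift Level.lower (toℕ i <? toℕ (index (g (enum i))))

  numTwoCycles : (Carrier → Carrier) → ℕ
  numTwoCycles g = length (filter (isTwoCycleRep? g) (L.allFin size))

module Submission where

-- Write x̄ = x ^ q for the conjugation of 𝔽_{q²} over 𝔽_q. Then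
-- f x = c x (x̄ − x) and f (f x) = μ x · x with μ x = −c³ (x + x̄) (x − x̄)².
-- A nonzero fixed point would give c (x̄ − x) = 1 = c (x − x̄), i.e. 2 = 0, so
-- the points on two-cycles are the x ≠ 0 with μ x = 1. Such an x is determined
-- by v = x − x̄, a nonzero element with v̄ = −v, through x + x̄ = −1/(c³ v²);
-- conversely every such v arises. These v form 𝔽_q · d minus 0 for any d ≠ 0
-- with d̄ = −d, so there are q − 1 points on two-cycles and (q − 1)/2 cycles.

open import Defs
open import Level using (Level; _⊔_; lift)
open import Algebra.Bundles using (RawRing; CommutativeRing)
open import Algebra.Solver.Ring.AlmostCommutativeRing using (fromCommutativeRing; _-Raw-AlmostCommutative⟶_)
open import Data.Bool.Base using (if_then_else_; true; false)
open import Data.Fin as Fin using (Fin; toℕ)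
import Data.Fin.Properties as Fin
open import Data.Fin.Permutation using (Permutation; permutation)
open import Data.List.Base using (length; filter; tabulate; allFin)
open import Data.Maybe using (Maybe; just; nothing)
open import Data.Nat as ℕ using (ℕ; zero; suc; _!; _<_; _≤_; _≥_; _∸_; _%_; _/_; z≤n; s≤s)
import Data.Nat.Properties as ℕ
open import Data.Nat.Combinatorics using (_C_; nCn≡1; nCk≡nC[n∸k]; nCk≡n!/k![n-k]!; k![n∸k]!∣n!)
open import Data.Nat.Divisibility using (_∣_; ∣⇒≤; divides)
open import Data.Nat.DivMod using (m/n*n≡m; m*n/n≡m; m≡m%n+[m/n]*n)
open import Data.Nat.Primality using (Prime; euclidsLemma; prime⇒nonTrivial; prime⇒nonZero; ¬prime[0]; ¬prime[1])
open import Data.Product using (∃; _×_; _,_; proj₁; proj₂; map)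
open import Data.Sum using (_⊎_; inj₁; inj₂)
open import Data.Unit using (tt)
import Data.Vec.Functional as Vector
open import Function using (_∘_; id; case_of_)
open import Relation.Nullary using (¬_; Dec; yes; no; does; contradiction)
open import Relation.Nullary.Decidable using (_×-dec_; ¬?)
open import Relation.Binary.Core using (_Preserves_⟶_; _Preserves₂_⟶_⟶_)
open import Relation.Binary.Definitions using (_Respects_; tri<; tri≈; tri>)
open import Relation.Binary.PropositionalEquality as ≡ using (_≡_; _≢_)

-- Algebra.Solver.Ring needs a coefficient ring, with decidable equality,
-- mapping into R. The integers, as pairs (m , n) standing for m − n, work
-- for every commutative ring; the pairs are kept normalised because the
-- solver compares normal forms with _≡_.
module IntegerCoefficientSolver {a ℓ} (R : CommutativeRing a ℓ) where
  open CommutativeRing R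
  open import Relation.Binary.Reasoning.Setoid setoid
  open import Algebra.Properties.Group +-group
    using (//-rightDividesˡ; x≈z//y; ∙-cancelʳ)
  open import Algebra.Properties.AbelianGroup +-abelianGroup using (⁻¹-anti-homo‿-)
  open import Algebra.Properties.Monoid.Mult +-monoid using (×-homo-+) renaming (_×_ to _·_)
  open import Algebra.Properties.Semiring.Mult semiring using (×1-homo-*)
  import Algebra.Solver.Ring.NaturalCoefficients.Default commutativeSemiring as ℕSolver

  ℤ² : Set
  ℤ² = ℕ × ℕ

  normalise : ℤ² → ℤ²
  normalise (m , n) = m ℕ.∸ n , n ℕ.∸ m

  ℤ²-rawRing : RawRing _ _
  ℤ²-rawRing = record
    { Carrier = ℤ²
    ; _≈_ = _≡_
    ; _+_ = λ { (m , n) (m′ , n′) → normalise (m ℕ.+ m′ , n ℕ.+ n′) }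
    ; _*_ = λ { (m , n) (m′ , n′) →
                normalise (m ℕ.* m′ ℕ.+ n ℕ.* n′ , m ℕ.* n′ ℕ.+ n ℕ.* m′) }
    ; -_ = λ { (m , n) → n , m }
    ; 0# = 0 , 0
    ; 1# = 1 , 0
    }

  x≈y+z⇒x-z≈y : ∀ {x y z} → x ≈ y + z → x - z ≈ y
  x≈y+z⇒x-z≈y eq = sym (x≈z//y _ _ _ (sym eq))

  ⟦_⟧ : ℤ² → Carrier
  ⟦ m , n ⟧ = m · 1# - n · 1#

  ⟦⟧-cong : ∀ {m n m′ n′} → m ℕ.+ n′ ≡ m′ ℕ.+ n → ⟦ m , n ⟧ ≈ ⟦ m′ , n′ ⟧
  ⟦⟧-cong {m} {n} {m′} {n′} eq = x≈y+z⇒x-z≈y (∙-cancelʳ (n′ · 1#) _ _ (begin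
    m · 1# + n′ · 1#                          ≈⟨ ×-homo-+ 1# m n′ ⟨
    (m ℕ.+ n′) · 1#                           ≡⟨ ≡.cong (_· 1#) eq ⟩
    (m′ ℕ.+ n) · 1#                           ≈⟨ ×-homo-+ 1# m′ n ⟩
    m′ · 1# + n · 1#                          ≈⟨ +-congʳ (//-rightDividesˡ (n′ · 1#) (m′ · 1#)) ⟨
    (⟦ m′ , n′ ⟧ + n′ · 1#) + n · 1#          ≈⟨ +-assoc _ _ _ ⟩
    ⟦ m′ , n′ ⟧ + (n′ · 1# + n · 1#)          ≈⟨ +-congˡ (+-comm _ _) ⟩
    ⟦ m′ , n′ ⟧ + (n · 1# + n′ · 1#)          ≈⟨ +-assoc _ _ _ ⟨
    (⟦ m′ , n′ ⟧ + n · 1#) + n′ · 1#          ∎))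

  ⟦normalise⟧ : ∀ z → ⟦ normalise z ⟧ ≈ ⟦ z ⟧
  ⟦normalise⟧ (m , n) = ⟦⟧-cong {m ℕ.∸ n} {n ℕ.∸ m} {m} {n} (m∸n+n≡m+[n∸m] m n)
    where
    m∸n+n≡m+[n∸m] : ∀ m n → m ℕ.∸ n ℕ.+ n ≡ m ℕ.+ (n ℕ.∸ m)
    m∸n+n≡m+[n∸m] zero    zero    = ≡.refl
    m∸n+n≡m+[n∸m] zero    (suc n) = ≡.refl
    m∸n+n≡m+[n∸m] (suc m) zero    = ≡.refl
    m∸n+n≡m+[n∸m] (suc m) (suc n) =
      ≡.trans (ℕ.+-suc (m ℕ.∸ n) n) (≡.cong suc (m∸n+n≡m+[n∸m] m n))

  -- Writing ⟦ m , n ⟧ as x with x + n · 1# ≈ m · 1#, both homomorphism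
  -- laws become semiring identities.
  ⟦⟧-+ : ∀ z w → ⟦ RawRing._+_ ℤ²-rawRing z w ⟧ ≈ ⟦ z ⟧ + ⟦ w ⟧
  ⟦⟧-+ (m , n) (m′ , n′) = trans (⟦normalise⟧ (m ℕ.+ m′ , n ℕ.+ n′)) (x≈y+z⇒x-z≈y (begin
    (m ℕ.+ m′) · 1#            ≈⟨ ×-homo-+ 1# m m′ ⟩
    M + M′                     ≈⟨ +-cong (//-rightDividesˡ N M) (//-rightDividesˡ N′ M′) ⟨
    (X + N) + (X′ + N′)
      ≈⟨ ℕSolver.solve 4 (λ X N X′ N′ → (X :+ N) :+ (X′ :+ N′) := (X :+ X′) :+ (N :+ N′)) refl X N X′ N′ ⟩
    (X + X′) + (N + N′)        ≈⟨ +-congˡ (×-homo-+ 1# n n′) ⟨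
    (X + X′) + (n ℕ.+ n′) · 1# ∎))
    where
    open ℕSolver using (_:+_; _:=_)
    M = m · 1#
    N = n · 1#
    M′ = m′ · 1#
    N′ = n′ · 1#
    X = M - N
    X′ = M′ - N′

  ⟦⟧-* : ∀ z w → ⟦ RawRing._*_ ℤ²-rawRing z w ⟧ ≈ ⟦ z ⟧ * ⟦ w ⟧
  ⟦⟧-* (m , n) (m′ , n′) = trans (⟦normalise⟧ (m ℕ.* m′ ℕ.+ n ℕ.* n′ , m ℕ.* n′ ℕ.+ n ℕ.* m′)) (x≈y+z⇒x-z≈y (begin
    (m ℕ.* m′ ℕ.+ n ℕ.* n′) · 1#        ≈⟨ ×-homo-+ 1# (m ℕ.* m′) (n ℕ.* n′) ⟩
    (m ℕ.* m′) · 1# + (n ℕ.* n′) · 1#   ≈⟨ +-cong (×1-homo-* m m′) (×1-homo-* n n′) ⟩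
    M * M′ + N * N′                     ≈⟨ +-congʳ (*-cong (//-rightDividesˡ N M) (//-rightDividesˡ N′ M′)) ⟨
    (X + N) * (X′ + N′) + N * N′
      ≈⟨ ℕSolver.solve 4 (λ X N X′ N′ → (X :+ N) :* (X′ :+ N′) :+ N :* N′
                                     := X :* X′ :+ ((X :+ N) :* N′ :+ N :* (X′ :+ N′))) refl X N X′ N′ ⟩
    X * X′ + ((X + N) * N′ + N * (X′ + N′))
      ≈⟨ +-congˡ (+-cong (*-congʳ (//-rightDividesˡ N M)) (*-congˡ (//-rightDividesˡ N′ M′))) ⟩
    X * X′ + (M * N′ + N * M′)          ≈⟨ +-congˡ (+-cong (×1-homo-* m n′) (×1-homo-* n m′)) ⟨
    X * X′ + ((m ℕ.* n′) · 1# + (n ℕ.* m′) · 1#)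
      ≈⟨ +-congˡ (×-homo-+ 1# (m ℕ.* n′) (n ℕ.* m′)) ⟨
    X * X′ + (m ℕ.* n′ ℕ.+ n ℕ.* m′) · 1# ∎))
    where
    open ℕSolver using (_:+_; _:*_; _:=_)
    M = m · 1#
    N = n · 1#
    M′ = m′ · 1#
    N′ = n′ · 1#
    X = M - N
    X′ = M′ - N′

  ⟦⟧-homomorphism : ℤ²-rawRing -Raw-AlmostCommutative⟶ fromCommutativeRing R
  ⟦⟧-homomorphism = record
    { ⟦_⟧ = ⟦_⟧
    ; +-homo = ⟦⟧-+
    ; *-homo = ⟦⟧-*
    ; -‿homo = λ { (m , n) → sym (⁻¹-anti-homo‿- (m · 1#) (n · 1#)) }
    ; 0-homo = -‿inverseʳ 0#
    ; 1-homo = x≈y+z⇒x-z≈y refl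
    }

  ⟦⟧-≟ : ∀ z w → Maybe (⟦ z ⟧ ≈ ⟦ w ⟧)
  ⟦⟧-≟ (m , n) (m′ , n′) with m ℕ.+ n′ ℕ.≟ m′ ℕ.+ n
  ... | yes eq = just (⟦⟧-cong {m} {n} {m′} {n′} eq)
  ... | no _   = nothing

  open import Algebra.Solver.Ring ℤ²-rawRing (fromCommutativeRing R) ⟦⟧-homomorphism ⟦⟧-≟ public
    using (solve; _:=_; _:+_; _:*_; _:-_; :-_)

prime≥2 : ∀ {p} → Prime p → 2 ≤ p
prime≥2 {p} pp = ℕ.nonTrivial⇒n>1 p {{prime⇒nonTrivial pp}}

prime∣!⇒≤ : ∀ {p} m → Prime p → p ∣ m ! → p ≤ m
prime∣!⇒≤ zero    pp p∣1 = contradiction (∣⇒≤ p∣1) (ℕ.<⇒≱ (prime≥2 pp))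
prime∣!⇒≤ (suc m) pp p∣m! with euclidsLemma (suc m) (m !) pp p∣m!
... | inj₁ p∣1+m = ∣⇒≤ p∣1+m
... | inj₂ p∣m!  = ℕ.m≤n⇒m≤1+n (prime∣!⇒≤ m pp p∣m!)

n∣n! : ∀ {n} → 0 < n → n ∣ n !
n∣n! {suc n} _ = divides (n !) (ℕ.*-comm (suc n) (n !))

-- p divides p! = (p C k) · k! · (p ∸ k)!, but neither k! nor (p ∸ k)!.
prime∣binomial : ∀ {p k} → Prime p → 0 < k → k < p → p ∣ p C k
prime∣binomial {p} {k} pp 0<k k<p
  with euclidsLemma (p C k) (k ! ℕ.* (p ∸ k) !) pp p∣product
  where
  instance _ = ℕ._!*_!≢0 k (p ∸ k)
  p∣product : p ∣ (p C k) ℕ.* (k ! ℕ.* (p ∸ k) !)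
  p∣product = ≡.subst (p ∣_) (≡.sym (begin
    (p C k) ℕ.* (k ! ℕ.* (p ∸ k) !) ≡⟨ ≡.cong (ℕ._* (k ! ℕ.* (p ∸ k) !)) (nCk≡n!/k![n-k]! (ℕ.<⇒≤ k<p)) ⟩
    _                           ≡⟨ m/n*n≡m (k![n∸k]!∣n! (ℕ.<⇒≤ k<p)) ⟩
    p !                         ∎)) (n∣n! (ℕ.<-trans 0<k k<p))
    where open ≡.≡-Reasoning
... | inj₁ p∣pCk = p∣pCk
... | inj₂ p∣k![p∸k]! with euclidsLemma (k !) ((p ∸ k) !) pp p∣k![p∸k]!
...   | inj₁ p∣k!     = contradiction (prime∣!⇒≤ k pp p∣k!) (ℕ.<⇒≱ k<p)
...   | inj₂ p∣[p∸k]! = contradiction (prime∣!⇒≤ (p ∸ k) pp p∣[p∸k]!) (ℕ.<⇒≱ (ℕ.∸-monoʳ-< 0<k (ℕ.<⇒≤ k<p)))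

module Counting where
  open import Data.Nat using (_+_; _*_)
  import Algebra.Properties.CommutativeMonoid.Sum ℕ.+-0-commutativeMonoid as ∑
  open ∑ using (sum)
  open import Algebra.Properties.Semiring.Sum ℕ.+-*-semiring using (*-distribˡ-sum; *-distribʳ-sum)
  open ≡.≡-Reasoning

  private
    variable
      p q r : Level
      m n : ℕ
      A B : Set p

  𝟙 : Dec A → ℕ
  𝟙 d = if does d then 1 else 0

  𝟙-yes : (d : Dec A) → A → 𝟙 d ≡ 1
  𝟙-yes (yes _) _ = ≡.refl
  𝟙-yes (no ¬a) a = contradiction a ¬a

  𝟙-no : (d : Dec A) → ¬ A → 𝟙 d ≡ 0
  𝟙-no (yes a) ¬a = contradiction a ¬a
  𝟙-no (no _)  _  = ≡.refl

  𝟙-cong : (dA : Dec A) (dB : Dec B) → (A → B) → (B → A) → 𝟙 dA ≡ 𝟙 dB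
  𝟙-cong (yes a) dB f g = ≡.sym (𝟙-yes dB (f a))
  𝟙-cong (no ¬a) dB f g = ≡.sym (𝟙-no dB (¬a ∘ g))

  𝟙-× : (dA : Dec A) (dB : Dec B) → 𝟙 dA * 𝟙 dB ≡ 𝟙 (dA ×-dec dB)
  𝟙-× (yes _) (yes _) = ≡.refl
  𝟙-× (yes _) (no _)  = ≡.refl
  𝟙-× (no _)  (yes _) = ≡.refl
  𝟙-× (no _)  (no _)  = ≡.refl

  module _ {P : Fin n → Set p} (P? : ∀ i → Dec (P i)) where

    count : ℕ
    count = sum (λ i → 𝟙 (P? i))

    length-filter-allFin : length (filter P? (allFin n)) ≡ count
    length-filter-allFin = go id
      where
      go : ∀ {m} (f : Fin m → Fin n) →
           length (filter P? (tabulate f)) ≡ sum (λ i → 𝟙 (P? (f i)))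
      go {zero}  f = ≡.refl
      go {suc m} f with does (P? (f Fin.zero))
      ... | true  = ≡.cong suc (go (f ∘ Fin.suc))
      ... | false = go (f ∘ Fin.suc)

  count-≡ : (j : Fin n) → count (Fin._≟ j) ≡ 1
  count-≡ {suc n} Fin.zero = ≡.cong₂ _+_ (𝟙-yes (Fin.zero {n} Fin.≟ Fin.zero) ≡.refl)
    (≡.trans (∑.sum-cong-≋ {n} (λ i → 𝟙-no (Fin.suc i Fin.≟ Fin.zero) λ ()))
             (∑.sum-replicate-zero n))
  count-≡ {suc n} (Fin.suc j) = ≡.cong₂ _+_ (𝟙-no (Fin.zero Fin.≟ Fin.suc j) λ ())
    (≡.trans (∑.sum-cong-≋ {n} (λ i → 𝟙-cong (Fin.suc i Fin.≟ Fin.suc j) (i Fin.≟ j)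
                                          Fin.suc-injective (≡.cong Fin.suc)))
             (count-≡ j))

  -- Every a lies in exactly one fibre of φ.
  ∑-fibres : (φ : Fin n → Fin m) (f : Fin n → ℕ) →
             sum (λ x → sum (λ a → f a * 𝟙 (x Fin.≟ φ a))) ≡ sum f
  ∑-fibres φ f = begin
    sum (λ x → sum (λ a → f a * 𝟙 (x Fin.≟ φ a))) ≡⟨ ∑.∑-comm (λ x a → f a * 𝟙 (x Fin.≟ φ a)) ⟩
    sum (λ a → sum (λ x → f a * 𝟙 (x Fin.≟ φ a))) ≡⟨ ∑.sum-cong-≋ (λ a → *-distribˡ-sum (f a) (λ x → 𝟙 (x Fin.≟ φ a))) ⟨
    sum (λ a → f a * sum (λ x → 𝟙 (x Fin.≟ φ a))) ≡⟨ ∑.sum-cong-≋ (λ a → ≡.cong (f a *_) (count-≡ (φ a))) ⟩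
    sum (λ a → f a * 1)                          ≡⟨ ∑.sum-cong-≋ (λ a → ℕ.*-identityʳ (f a)) ⟩
    sum f                                        ∎

  count-cong : {P : Fin n → Set p} {Q : Fin n → Set q}
               (P? : ∀ i → Dec (P i)) (Q? : ∀ i → Dec (Q i)) →
               (∀ i → P i → Q i) → (∀ i → Q i → P i) → count P? ≡ count Q?
  count-cong P? Q? P⇒Q Q⇒P = ∑.sum-cong-≋ (λ i → 𝟙-cong (P? i) (Q? i) (P⇒Q i) (Q⇒P i))


  count-all : count (λ (_ : Fin n) → yes tt) ≡ n
  count-all {zero}  = ≡.refl
  count-all {suc n} = ≡.cong suc (count-all {n})

  count-none : {P : Fin n → Set p} (P? : ∀ i → Dec (P i)) → (∀ i → ¬ P i) → count P? ≡ 0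
  count-none {n} P? ¬P = ≡.trans (∑.sum-cong-≋ (λ i → 𝟙-no (P? i) (¬P i))) (∑.sum-replicate-zero n)

  count-⊎ : {P : Fin n → Set p} {Q : Fin n → Set q} {R : Fin n → Set r}
            (P? : ∀ i → Dec (P i)) (Q? : ∀ i → Dec (Q i)) (R? : ∀ i → Dec (R i)) →
            (∀ i → P i → Q i ⊎ R i) → (∀ i → Q i → P i) → (∀ i → R i → P i) →
            (∀ i → Q i → ¬ R i) → count P? ≡ count Q? + count R?
  count-⊎ {P = P} {Q} {R} P? Q? R? split Q⇒P R⇒P disjoint =
    ≡.trans (∑.sum-cong-≋ 𝟙-split) (∑.∑-distrib-+ (λ i → 𝟙 (Q? i)) (λ i → 𝟙 (R? i)))
    where
    𝟙-split : ∀ i → 𝟙 (P? i) ≡ 𝟙 (Q? i) + 𝟙 (R? i)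
    𝟙-split i with P? i
    ... | no ¬Pi = ≡.sym (≡.cong₂ _+_ (𝟙-no (Q? i) (¬Pi ∘ Q⇒P i)) (𝟙-no (R? i) (¬Pi ∘ R⇒P i)))
    ... | yes Pi with split i Pi
    ...   | inj₁ Qi = ≡.sym (≡.cong₂ _+_ (𝟙-yes (Q? i) Qi) (𝟙-no (R? i) (disjoint i Qi)))
    ...   | inj₂ Ri = ≡.sym (≡.cong₂ _+_ (𝟙-no (Q? i) (λ Qi → disjoint i Qi Ri)) (𝟙-yes (R? i) Ri))

  count-reindex : {P : Fin m → Set p} {Q : Fin n → Set q}
                  (P? : ∀ x → Dec (P x)) (Q? : ∀ a → Dec (Q a))
                  (φ : Fin n → Fin m) (ψ : Fin m → Fin n) →
                  (∀ x → P x → Q (ψ x)) → (∀ a → Q a → P (φ a)) →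
                  (∀ x → P x → φ (ψ x) ≡ x) → (∀ a → Q a → ψ (φ a) ≡ a) →
                  count P? ≡ count Q?
  count-reindex {P = P} {Q} P? Q? φ ψ Pψ Qφ φψ ψφ = begin
    count P?                                      ≡⟨ ∑.sum-cong-≋ fibre ⟨
    sum (λ x → sum (λ a → 𝟙 (Q? a) * 𝟙 (x Fin.≟ φ a))) ≡⟨ ∑-fibres φ (λ a → 𝟙 (Q? a)) ⟩
    count Q?                                      ∎
    where
    fibre : ∀ x → sum (λ a → 𝟙 (Q? a) * 𝟙 (x Fin.≟ φ a)) ≡ 𝟙 (P? x)
    fibre x = ≡.trans (∑.sum-cong-≋ (λ a → 𝟙-× (Q? a) (x Fin.≟ φ a))) (fibre′ (P? x))
      where
      fibre′ : (d : Dec (P x)) → count (λ a → Q? a ×-dec (x Fin.≟ φ a)) ≡ 𝟙 d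
      fibre′ (yes Px) = ≡.trans
        (count-cong (λ a → Q? a ×-dec (x Fin.≟ φ a)) (Fin._≟ ψ x)
          (λ a (Qa , x≡φa) → ≡.trans (≡.sym (ψφ a Qa)) (≡.cong ψ (≡.sym x≡φa)))
          (λ { a ≡.refl → Pψ x Px , ≡.sym (φψ x Px) }))
        (count-≡ (ψ x))
      fibre′ (no ¬Px) = count-none (λ a → Q? a ×-dec (x Fin.≟ φ a)) (λ { a (Qa , ≡.refl) → ¬Px (Qφ a Qa) })

  module _ {P : Fin m → Fin n → Set p} (P? : ∀ a b → Dec (P a b)) where

    count₂ : ℕ
    count₂ = sum (λ a → count (P? a))

  count₂-× : {P : Fin m → Set p} {Q : Fin n → Set q}
             (P? : ∀ a → Dec (P a)) (Q? : ∀ b → Dec (Q b)) →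
             count₂ (λ a b → P? a ×-dec Q? b) ≡ count P? * count Q?
  count₂-× P? Q? = begin
    sum (λ a → sum (λ b → 𝟙 (P? a ×-dec Q? b)))  ≡⟨ ∑.sum-cong-≋ (λ a → ∑.sum-cong-≋ (λ b → 𝟙-× (P? a) (Q? b))) ⟨
    sum (λ a → sum (λ b → 𝟙 (P? a) * 𝟙 (Q? b)))  ≡⟨ ∑.sum-cong-≋ (λ a → *-distribˡ-sum (𝟙 (P? a)) (λ b → 𝟙 (Q? b))) ⟨
    sum (λ a → 𝟙 (P? a) * count Q?)             ≡⟨ *-distribʳ-sum (count Q?) (λ a → 𝟙 (P? a)) ⟨
    count P? * count Q?                         ∎

  count-reindex₂ : ∀ {n′} {P : Fin m → Set p} {Q : Fin n → Fin n′ → Set q}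
                   (P? : ∀ x → Dec (P x)) (Q? : ∀ a b → Dec (Q a b))
                   (φ : Fin n → Fin n′ → Fin m) (ψ₁ : Fin m → Fin n) (ψ₂ : Fin m → Fin n′) →
                   (∀ x → P x → Q (ψ₁ x) (ψ₂ x)) → (∀ a b → Q a b → P (φ a b)) →
                   (∀ x → P x → φ (ψ₁ x) (ψ₂ x) ≡ x) →
                   (∀ a b → Q a b → ψ₁ (φ a b) ≡ a × ψ₂ (φ a b) ≡ b) →
                   count P? ≡ count₂ Q?
  count-reindex₂ {n = n} {n′ = n′} {P} {Q} P? Q? φ ψ₁ ψ₂ Pψ Qφ φψ ψφ = begin
    count P?                ≡⟨ ∑.sum-cong-≋ fibre ⟨
    sum (λ x → sum (λ a → sum (λ b → 𝟙 (Q? a b) * 𝟙 (x Fin.≟ φ a b))))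
      ≡⟨ ∑.∑-comm (λ x a → sum (λ b → 𝟙 (Q? a b) * 𝟙 (x Fin.≟ φ a b))) ⟩
    sum (λ a → sum (λ x → sum (λ b → 𝟙 (Q? a b) * 𝟙 (x Fin.≟ φ a b))))
      ≡⟨ ∑.sum-cong-≋ (λ a → ∑-fibres (φ a) (λ b → 𝟙 (Q? a b))) ⟩
    count₂ Q?               ∎
    where
    Q×≡? : ∀ x a b → Dec (Q a b × x ≡ φ a b)
    Q×≡? x a b = Q? a b ×-dec (x Fin.≟ φ a b)
    fibre : ∀ x → sum (λ a → sum (λ b → 𝟙 (Q? a b) * 𝟙 (x Fin.≟ φ a b))) ≡ 𝟙 (P? x)
    fibre x = ≡.trans (∑.sum-cong-≋ (λ a → ∑.sum-cong-≋ (λ b → 𝟙-× (Q? a b) (x Fin.≟ φ a b))))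
                      (fibre′ (P? x))
      where
      fibre′ : (d : Dec (P x)) → count₂ (Q×≡? x) ≡ 𝟙 d
      fibre′ (yes Px) = begin
        count₂ (Q×≡? x)
          ≡⟨ ∑.sum-cong-≋ (λ a → count-cong (Q×≡? x a) (λ b → (a Fin.≟ ψ₁ x) ×-dec (b Fin.≟ ψ₂ x))
               (λ b (Qab , x≡φab) → ≡.trans (≡.sym (proj₁ (ψφ a b Qab))) (≡.cong ψ₁ (≡.sym x≡φab))
                                   , ≡.trans (≡.sym (proj₂ (ψφ a b Qab))) (≡.cong ψ₂ (≡.sym x≡φab)))
               (λ { b (≡.refl , ≡.refl) → Pψ x Px , ≡.sym (φψ x Px) })) ⟩
        count₂ (λ a b → (a Fin.≟ ψ₁ x) ×-dec (b Fin.≟ ψ₂ x))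
          ≡⟨ count₂-× (Fin._≟ ψ₁ x) (Fin._≟ ψ₂ x) ⟩
        count (Fin._≟ ψ₁ x) * count (Fin._≟ ψ₂ x)
          ≡⟨ ≡.cong₂ _*_ (count-≡ (ψ₁ x)) (count-≡ (ψ₂ x)) ⟩
        1 ∎
      fibre′ (no ¬Px) = ≡.trans
        (∑.sum-cong-≋ (λ a → count-none (Q×≡? x a) (λ { b (Qab , ≡.refl) → ¬Px (Qφ a b Qab) })))
        (∑.sum-replicate-zero n)

module FiniteFieldTheory {a ℓ} (F : FiniteField a ℓ) where
  open FiniteField F
  open Counting
  open IntegerCoefficientSolver commRing using (solve; _:=_; _:+_; _:*_; _:-_; :-_; x≈y+z⇒x-z≈y)
  open import Relation.Binary.Reasoning.Setoid setoid
  open import Algebra.Properties.Group +-group using (//-rightDividesˡ; ∙-cancelʳ)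
  open import Algebra.Properties.Monoid.Mult +-monoid using (×-congʳ; ×-assocˡ; ×-homo-1) renaming (_×_ to _·_)
  open import Algebra.Properties.Semiring.Mult semiring using (×1-homo-*; ×-assoc-*)
  import Algebra.Properties.CommutativeMonoid.Sum +-commutativeMonoid as ∑
  import Algebra.Properties.CommutativeMonoid.Sum *-commutativeMonoid as ∏
  import Algebra.Properties.Semiring.Exp semiring as Exp
  import Algebra.Properties.CommutativeSemiring.Binomial commutativeSemiring as Binomial
  open import Algebra.Properties.Monoid.Mult *-monoid using () renaming (_×_ to _×ᵐ_)

  #_ : ∀ {p} {P : Carrier → Set p} → (∀ x → Dec (P x)) → ℕ
  # P? = count (λ i → P? (enum i))

  index-resp : ∀ {p} {P : Carrier → Set p} → P Respects _≈_ → ∀ {x} → P x → P (enum (index x))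
  index-resp resp Px = resp (sym (enum-index _)) Px

  index≡ : ∀ {x j} → x ≈ enum j → index x ≡ j
  index≡ {j = j} x≈eⱼ = ≡.trans (index-cong x≈eⱼ) (index-enum j)

  enum-injective : ∀ {i j} → enum i ≈ enum j → i ≡ j
  enum-injective {i} eᵢ≈eⱼ = ≡.trans (≡.sym (index-enum i)) (index≡ eᵢ≈eⱼ)

  ^-congˡ : ∀ {x y} n → x ≈ y → x ^ n ≈ y ^ n
  ^-congˡ zero    x≈y = refl
  ^-congˡ (suc n) x≈y = *-cong x≈y (^-congˡ n x≈y)

  1^n≈1 : ∀ n → 1# ^ n ≈ 1#
  1^n≈1 zero    = refl
  1^n≈1 (suc n) = trans (*-identityˡ _) (1^n≈1 n)

  ^-homo-* : ∀ x m n → x ^ (m ℕ.+ n) ≈ x ^ m * x ^ n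
  ^-homo-* x zero    n = sym (*-identityˡ _)
  ^-homo-* x (suc m) n = trans (*-congˡ (^-homo-* x m n)) (sym (*-assoc _ _ _))

  ^-distrib-* : ∀ x y n → (x * y) ^ n ≈ x ^ n * y ^ n
  ^-distrib-* x y zero    = sym (*-identityˡ _)
  ^-distrib-* x y (suc n) = trans (*-congˡ (^-distrib-* x y n))
    (solve 4 (λ x y xⁿ yⁿ → (x :* y) :* (xⁿ :* yⁿ) := (x :* xⁿ) :* (y :* yⁿ)) refl x y (x ^ n) (y ^ n))

  ^-assocʳ : ∀ x m n → x ^ (m ℕ.* n) ≈ (x ^ m) ^ n
  ^-assocʳ x zero    n = sym (1^n≈1 n)
  ^-assocʳ x (suc m) n = begin
    x ^ (n ℕ.+ m ℕ.* n)     ≈⟨ ^-homo-* x n (m ℕ.* n) ⟩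
    x ^ n * x ^ (m ℕ.* n)   ≈⟨ *-congˡ (^-assocʳ x m n) ⟩
    x ^ n * (x ^ m) ^ n     ≈⟨ ^-distrib-* x (x ^ m) n ⟨
    (x * x ^ m) ^ n         ∎

  -- A total inverse, with junk value 0# ⁻¹ = 0#.
  _⁻¹ : Carrier → Carrier
  x ⁻¹ with x ≈? 0#
  ... | yes _   = 0#
  ... | no x≉0  = proj₁ (inverse x x≉0)

  x*x⁻¹≈1 : ∀ {x} → ¬ x ≈ 0# → x * x ⁻¹ ≈ 1#
  x*x⁻¹≈1 {x} x≉0 with x ≈? 0#
  ... | yes x≈0 = contradiction x≈0 x≉0
  ... | no x≉0  = proj₂ (inverse x x≉0)

  x⁻¹*x≈1 : ∀ {x} → ¬ x ≈ 0# → x ⁻¹ * x ≈ 1#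
  x⁻¹*x≈1 x≉0 = trans (*-comm _ _) (x*x⁻¹≈1 x≉0)

  *-cancelˡ : ∀ {x y z} → ¬ x ≈ 0# → x * y ≈ x * z → y ≈ z
  *-cancelˡ {x} {y} {z} x≉0 xy≈xz = begin
    y                ≈⟨ *-identityˡ y ⟨
    1# * y           ≈⟨ *-congʳ (x⁻¹*x≈1 x≉0) ⟨
    (x ⁻¹ * x) * y   ≈⟨ *-assoc _ _ _ ⟩
    x ⁻¹ * (x * y)   ≈⟨ *-congˡ xy≈xz ⟩
    x ⁻¹ * (x * z)   ≈⟨ *-assoc _ _ _ ⟨
    (x ⁻¹ * x) * z   ≈⟨ *-congʳ (x⁻¹*x≈1 x≉0) ⟩
    1# * z           ≈⟨ *-identityˡ z ⟩
    z                ∎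

  x*y≈1⇒y≈x⁻¹ : ∀ {x y} → x * y ≈ 1# → y ≈ x ⁻¹
  x*y≈1⇒y≈x⁻¹ {x} {y} xy≈1 = *-cancelˡ x≉0 (trans xy≈1 (sym (x*x⁻¹≈1 x≉0)))
    where
    x≉0 : ¬ x ≈ 0#
    x≉0 x≈0 = 1≉0 (trans (sym xy≈1) (trans (*-congʳ x≈0) (zeroˡ y)))

  x≈0⇒x⁻¹≈0 : ∀ {x} → x ≈ 0# → x ⁻¹ ≈ 0#
  x≈0⇒x⁻¹≈0 {x} x≈0 with x ≈? 0#
  ... | yes _   = refl
  ... | no x≉0  = contradiction x≈0 x≉0

  ⁻¹-cong : ∀ {x y} → x ≈ y → x ⁻¹ ≈ y ⁻¹
  ⁻¹-cong {x} {y} x≈y = cases (y ≈? 0#)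
    where
    cases : Dec (y ≈ 0#) → x ⁻¹ ≈ y ⁻¹
    cases (yes y≈0) = trans (x≈0⇒x⁻¹≈0 (trans x≈y y≈0)) (sym (x≈0⇒x⁻¹≈0 y≈0))
    cases (no y≉0)  = sym (x*y≈1⇒y≈x⁻¹ (trans (*-congʳ x≈y) (x*x⁻¹≈1 y≉0)))

  *-nonzero : ∀ {x y} → ¬ x ≈ 0# → ¬ y ≈ 0# → ¬ x * y ≈ 0#
  *-nonzero {x} x≉0 y≉0 xy≈0 = y≉0 (*-cancelˡ x≉0 (trans xy≈0 (sym (zeroʳ x))))

  ^-nonzero : ∀ {x} n → ¬ x ≈ 0# → ¬ x ^ n ≈ 0#
  ^-nonzero zero    x≉0 = 1≉0
  ^-nonzero (suc n) x≉0 = *-nonzero x≉0 (^-nonzero n x≉0)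

  x^n≈0⇒x≈0 : ∀ {x} n → x ^ n ≈ 0# → x ≈ 0#
  x^n≈0⇒x≈0 {x} n xⁿ≈0 with x ≈? 0#
  ... | yes x≈0 = x≈0
  ... | no x≉0  = contradiction xⁿ≈0 (^-nonzero n x≉0)

  translation : Carrier → Permutation size size
  translation x = permutation (λ i → index (enum i + x)) (λ j → index (enum j - x))
    (λ j → ≡.trans (index-cong (trans (+-congʳ (enum-index _)) (//-rightDividesˡ x (enum j)))) (index-enum j))
    (λ i → ≡.trans (index-cong (trans (+-congʳ (enum-index _)) (x≈y+z⇒x-z≈y refl))) (index-enum i))

  -- Translation by x permutes the field, so ∑ y ≈ ∑ (y + x) ≈ ∑ y + size · x.
  size·x≈0 : ∀ x → size · x ≈ 0#
  size·x≈0 x = ∙-cancelʳ ∑F _ _ (begin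
    size · x + ∑F                               ≈⟨ +-congʳ (∑.sum-replicate size) ⟨
    ∑.sum {size} (λ _ → x) + ∑F                 ≈⟨ +-comm _ _ ⟩
    ∑F + ∑.sum {size} (λ _ → x)                 ≈⟨ ∑.∑-distrib-+ enum (λ _ → x) ⟨
    ∑.sum (λ i → enum i + x)                    ≈⟨ ∑.sum-cong-≋ (λ i → enum-index (enum i + x)) ⟨
    ∑.sum (λ i → enum (index (enum i + x)))     ≈⟨ ∑.sum-permute enum (translation x) ⟨
    ∑F                                          ≈⟨ +-identityˡ ∑F ⟨
    0# + ∑F                                     ∎)
    where
    ∑F = ∑.sum enum

  ∏-nonzero : ∀ {n} (f : Fin n → Carrier) → (∀ i → ¬ f i ≈ 0#) → ¬ ∏.sum f ≈ 0#
  ∏-nonzero {zero}  f f≉0 = 1≉0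
  ∏-nonzero {suc n} f f≉0 = *-nonzero (f≉0 Fin.zero) (∏-nonzero (f ∘ Fin.suc) (f≉0 ∘ Fin.suc))

  ∏-except-one : ∀ {n} (z : Fin n) (f : Fin n → Carrier) b →
                 f z ≈ 1# → (∀ j → j ≢ z → f j ≈ b) → ∏.sum f ≈ b ^ (n ℕ.∸ 1)
  ∏-except-one {suc n} z f b fz≈1 fj≈b = begin
    ∏.sum f                                   ≈⟨ ∏.sum-remove {i = z} f ⟩
    f z * ∏.sum (λ j → f (Fin.punchIn z j))   ≈⟨ *-cong fz≈1 (∏.sum-cong-≋ (λ j → fj≈b _ (Fin.punchInᵢ≢i z j))) ⟩
    1# * ∏.sum {n} (λ _ → b)                  ≈⟨ *-identityˡ _ ⟩
    ∏.sum {n} (λ _ → b)                       ≈⟨ ∏.sum-replicate n ⟩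
    n ×ᵐ b                                    ≈⟨ ×ᵐ≈^ n b ⟩
    b ^ n                                     ∎
    where
    ×ᵐ≈^ : ∀ n x → n ×ᵐ x ≈ x ^ n
    ×ᵐ≈^ zero    x = refl
    ×ᵐ≈^ (suc n) x = *-congˡ (×ᵐ≈^ n x)

  if0_then_else_ : Carrier → Carrier → Carrier → Carrier
  if0 y then u else v with y ≈? 0#
  ... | yes _ = u
  ... | no _  = v

  if0-yes : ∀ {y u v} → y ≈ 0# → (if0 y then u else v) ≈ u
  if0-yes {y} y≈0 with y ≈? 0#
  ... | yes _   = refl
  ... | no y≉0  = contradiction y≈0 y≉0

  if0-no : ∀ {y u v} → ¬ y ≈ 0# → (if0 y then u else v) ≈ v
  if0-no {y} y≉0 with y ≈? 0#
  ... | yes y≈0 = contradiction y≈0 y≉0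
  ... | no _    = refl

  dilation : ∀ {b} → ¬ b ≈ 0# → Permutation size size
  dilation {b} b≉0 = permutation (λ i → index (b * enum i)) (λ j → index (b ⁻¹ * enum j))
    (λ j → ≡.trans (index-cong (cancel (x*x⁻¹≈1 b≉0))) (index-enum j))
    (λ i → ≡.trans (index-cong (cancel (x⁻¹*x≈1 b≉0))) (index-enum i))
    where
    cancel : ∀ {u v y} → u * v ≈ 1# → u * enum (index (v * y)) ≈ y
    cancel {u} {v} {y} uv≈1 = begin
      u * enum (index (v * y))  ≈⟨ *-congˡ (enum-index _) ⟩
      u * (v * y)               ≈⟨ *-assoc _ _ _ ⟨
      (u * v) * y               ≈⟨ *-congʳ uv≈1 ⟩
      1# * y                    ≈⟨ *-identityˡ y ⟩
      y                         ∎

  nonzeroPart : Carrier → Carrier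
  nonzeroPart y = if0 y then 1# else y

  nonzeroPart≉0 : ∀ y → ¬ nonzeroPart y ≈ 0#
  nonzeroPart≉0 y = cases (y ≈? 0#)
    where
    cases : Dec (y ≈ 0#) → ¬ nonzeroPart y ≈ 0#
    cases (yes y≈0) n≈0 = 1≉0 (trans (sym (if0-yes y≈0)) n≈0)
    cases (no y≉0)  n≈0 = y≉0 (trans (sym (if0-no y≉0)) n≈0)

  nonzeroPart-* : ∀ {b} → ¬ b ≈ 0# → ∀ {y z} → z ≈ b * y →
                  nonzeroPart z ≈ (if0 y then 1# else b) * nonzeroPart y
  nonzeroPart-* {b} b≉0 {y} {z} z≈by = cases (y ≈? 0#)
    where
    cases : Dec (y ≈ 0#) → nonzeroPart z ≈ (if0 y then 1# else b) * nonzeroPart y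
    cases (yes y≈0) = begin
      nonzeroPart z                                 ≈⟨ if0-yes (trans z≈by (trans (*-congˡ y≈0) (zeroʳ b))) ⟩
      1#                                            ≈⟨ *-identityˡ 1# ⟨
      1# * 1#                                       ≈⟨ *-cong (if0-yes y≈0) (if0-yes y≈0) ⟨
      (if0 y then 1# else b) * nonzeroPart y        ∎
    cases (no y≉0) = begin
      nonzeroPart z                                 ≈⟨ if0-no (λ z≈0 → *-nonzero b≉0 y≉0 (trans (sym z≈by) z≈0)) ⟩
      z                                             ≈⟨ z≈by ⟩
      b * y                                         ≈⟨ *-cong (if0-no y≉0) (if0-no y≉0) ⟨
      (if0 y then 1# else b) * nonzeroPart y        ∎

  -- Dilating by b permutes the field; comparing the products of the
  -- nonzero parts before and after gives b ^ (size ∸ 1) ≈ 1.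
  b^[size∸1]≈1 : ∀ {b} → ¬ b ≈ 0# → b ^ (size ℕ.∸ 1) ≈ 1#
  b^[size∸1]≈1 {b} b≉0 = sym (*-cancelˡ (∏-nonzero (nonzeroPart ∘ enum) (nonzeroPart≉0 ∘ enum)) (begin
    H * 1#                                              ≈⟨ *-identityʳ H ⟩
    H                                                   ≈⟨ ∏.sum-permute (nonzeroPart ∘ enum) (dilation b≉0) ⟩
    ∏.sum (λ i → nonzeroPart (enum (index (b * enum i))))
      ≈⟨ ∏.sum-cong-≋ (λ i → nonzeroPart-* b≉0 {enum i} (enum-index _)) ⟩
    ∏.sum (λ i → scale (enum i) * nonzeroPart (enum i))   ≈⟨ ∏.∑-distrib-+ (scale ∘ enum) (nonzeroPart ∘ enum) ⟩
    ∏.sum (scale ∘ enum) * H                            ≈⟨ *-congʳ (∏-except-one (index 0#) (scale ∘ enum) b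
                                                             (if0-yes (enum-index 0#)) scale-≢0) ⟩
    b ^ (size ℕ.∸ 1) * H                                ≈⟨ *-comm _ _ ⟩
    H * b ^ (size ℕ.∸ 1)                                ∎))
    where
    H = ∏.sum (nonzeroPart ∘ enum)
    scale : Carrier → Carrier
    scale y = if0 y then 1# else b
    scale-≢0 : ∀ j → j ≢ index 0# → scale (enum j) ≈ b
    scale-≢0 j j≢0 = if0-no (λ eⱼ≈0 → j≢0 (≡.sym (index≡ (sym eⱼ≈0))))

  size≡1+[size∸1] : size ≡ suc (size ℕ.∸ 1)
  size≡1+[size∸1] = inhabited (index 0#)
    where
    inhabited : ∀ {n} → Fin n → n ≡ suc (n ℕ.∸ 1)
    inhabited {suc n} _ = ≡.refl

  x^size≈x : ∀ x → x ^ size ≈ x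
  x^size≈x x = trans (reflexive (≡.cong (x ^_) size≡1+[size∸1])) (cases (x ≈? 0#))
    where
    cases : Dec (x ≈ 0#) → x * x ^ (size ℕ.∸ 1) ≈ x
    cases (yes x≈0) = trans (*-congʳ x≈0) (trans (zeroˡ _) (sym x≈0))
    cases (no x≉0)  = trans (*-congˡ (b^[size∸1]≈1 x≉0)) (*-identityʳ x)

  n·x≈[n·1]*x : ∀ n x → n · x ≈ (n · 1#) * x
  n·x≈[n·1]*x n x = sym (trans (×-assoc-* n 1# x) (×-congʳ n (*-identityˡ x)))

  n·0≈0 : ∀ n → n · 0# ≈ 0#
  n·0≈0 zero    = refl
  n·0≈0 (suc n) = trans (+-identityˡ _) (n·0≈0 n)

  ^≈^ᵉ : ∀ x n → x ^ n ≈ x Exp.^ n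
  ^≈^ᵉ x zero    = refl
  ^≈^ᵉ x (suc n) = *-congˡ (^≈^ᵉ x n)

  -- The middle binomial coefficients p C k are multiples of p.
  frobenius : ∀ {p} → Prime p → p · 1# ≈ 0# → ∀ x y → (x + y) ^ p ≈ x ^ p + y ^ p
  frobenius {0} pp = contradiction pp ¬prime[0]
  frobenius {1} pp = contradiction pp ¬prime[1]
  frobenius {p@(suc (suc m))} pp p·1≈0 x y = begin
    (x + y) ^ p                                         ≈⟨ ^≈^ᵉ (x + y) p ⟩
    (x + y) Exp.^ p                                     ≈⟨ Binomial.theorem p x y ⟩
    ∑.sum term                                          ≈⟨ +-congˡ (∑.sum-init-last (Vector.tail term)) ⟩
    term Fin.zero + (∑.sum middle + term (Fin.fromℕ p)) ≈⟨ +-cong first (+-cong middle≈0 last) ⟩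
    y Exp.^ p + (0# + x Exp.^ p)                        ≈⟨ +-congˡ (+-identityˡ _) ⟩
    y Exp.^ p + x Exp.^ p                               ≈⟨ +-comm _ _ ⟩
    x Exp.^ p + y Exp.^ p                               ≈⟨ +-cong (^≈^ᵉ x p) (^≈^ᵉ y p) ⟨
    x ^ p + y ^ p                                       ∎
    where
    term = Binomial.binomialTerm x y p
    middle = Vector.init (Vector.tail term)
    first : term Fin.zero ≈ y Exp.^ p
    first = begin
      (p C 0) · (1# * y Exp.^ p)  ≡⟨ ≡.cong (_· (1# * y Exp.^ p)) (≡.trans (nCk≡nC[n∸k] {0} {p} z≤n) (nCn≡1 p)) ⟩
      1 · (1# * y Exp.^ p)        ≈⟨ ×-homo-1 _ ⟩
      1# * y Exp.^ p              ≈⟨ *-identityˡ _ ⟩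
      y Exp.^ p                   ∎
    last : term (Fin.fromℕ p) ≈ x Exp.^ p
    last = term≈xᵖ (Fin.fromℕ p) (Fin.toℕ-fromℕ p)
      where
      term≈xᵖ : ∀ i → toℕ i ≡ p → term i ≈ x Exp.^ p
      term≈xᵖ i i≡p rewrite i≡p | nCn≡1 p | ℕ.n∸n≡0 p = trans (×-homo-1 _) (*-identityʳ _)
    term≈0 : ∀ i → 0 < toℕ i → toℕ i < p → term i ≈ 0#
    term≈0 i 0<i i<p with divides j pCi≡j*p ← prime∣binomial pp 0<i i<p = begin
      (p C toℕ i) · z   ≡⟨ ≡.cong (_· z) pCi≡j*p ⟩
      (j ℕ.* p) · z     ≈⟨ ×-assocˡ z j p ⟨
      j · (p · z)       ≈⟨ ×-congʳ j (trans (n·x≈[n·1]*x p z) (trans (*-congʳ p·1≈0) (zeroˡ z))) ⟩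
      j · 0#            ≈⟨ n·0≈0 j ⟩
      0#                ∎
      where
      z = Binomial.binomial x y p i
    middle≈0 : ∑.sum middle ≈ 0#
    middle≈0 = trans (∑.sum-cong-≋ {suc m} {middle} (λ i → term≈0 (Fin.suc (Fin.inject₁ i)) (s≤s z≤n)
                 (s≤s (≡.subst (ℕ._< suc m) (≡.sym (Fin.toℕ-inject₁ i)) (Fin.toℕ<n i)))))
               (∑.sum-replicate-zero (suc m))

  frobenius^ : ∀ {p} → Prime p → p · 1# ≈ 0# → ∀ j x y → (x + y) ^ (p ℕ.^ j) ≈ x ^ (p ℕ.^ j) + y ^ (p ℕ.^ j)
  frobenius^ pp p·1≈0 zero    x y = trans (*-identityʳ _) (sym (+-cong (*-identityʳ x) (*-identityʳ y)))
  frobenius^ {p} pp p·1≈0 (suc j) x y = begin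
    (x + y) ^ (p ℕ.* p ℕ.^ j)                   ≈⟨ ^-assocʳ (x + y) p (p ℕ.^ j) ⟩
    ((x + y) ^ p) ^ (p ℕ.^ j)                   ≈⟨ ^-congˡ (p ℕ.^ j) (frobenius pp p·1≈0 x y) ⟩
    (x ^ p + y ^ p) ^ (p ℕ.^ j)                 ≈⟨ frobenius^ pp p·1≈0 j (x ^ p) (y ^ p) ⟩
    (x ^ p) ^ (p ℕ.^ j) + (y ^ p) ^ (p ℕ.^ j)   ≈⟨ +-cong (^-assocʳ x p (p ℕ.^ j)) (^-assocʳ y p (p ℕ.^ j)) ⟨
    x ^ (p ℕ.* p ℕ.^ j) + y ^ (p ℕ.* p ℕ.^ j)   ∎

  n^j·1≈[n·1]^j : ∀ n j → (n ℕ.^ j) · 1# ≈ (n · 1#) ^ j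
  n^j·1≈[n·1]^j n zero    = +-identityʳ 1#
  n^j·1≈[n·1]^j n (suc j) = trans (×1-homo-* n (n ℕ.^ j)) (*-congˡ (n^j·1≈[n·1]^j n j))

  -- f agrees with a polynomial of degree d and leading coefficient t, in Horner form.
  data IsPolynomial : ℕ → Carrier → (Carrier → Carrier) → Set (a ⊔ ℓ) where
    constant : ∀ {t f} → (∀ x → f x ≈ t) → IsPolynomial 0 t f
    horner   : ∀ {d t f} g c → IsPolynomial d t g → (∀ x → f x ≈ x * g x + c) →
               IsPolynomial (suc d) t f

  x^n-polynomial : ∀ n → IsPolynomial n 1# (_^ n)
  x^n-polynomial zero    = constant (λ _ → refl)
  x^n-polynomial (suc n) = horner (_^ n) 0# (x^n-polynomial n) (λ x → sym (+-identityʳ _))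

  x^[2+n]-x-polynomial : ∀ n → IsPolynomial (2 ℕ.+ n) 1# (λ x → x ^ (2 ℕ.+ n) - x)
  x^[2+n]-x-polynomial n = horner (λ x → x ^ suc n - 1#) 0# x^[1+n]-1 (λ x → begin
    x * x ^ suc n - x          ≈⟨ +-congˡ (-‿cong (*-identityʳ x)) ⟨
    x * x ^ suc n - x * 1#     ≈⟨ solve 3 (λ x y o → x :* y :- x :* o := x :* (y :- o)) refl x (x ^ suc n) 1# ⟩
    x * (x ^ suc n - 1#)       ≈⟨ +-identityʳ _ ⟨
    x * (x ^ suc n - 1#) + 0#  ∎)
    where
    x^[1+n]-1 : IsPolynomial (suc n) 1# (λ x → x ^ suc n - 1#)
    x^[1+n]-1 = horner (_^ n) (- 1#) (x^n-polynomial n) (λ x → refl)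

  polynomial-division : ∀ {d t f} → IsPolynomial (suc d) t f → ∀ r →
                        ∃ λ h → IsPolynomial d t h × (∀ x → f x ≈ (x - r) * h x + f r)
  polynomial-division {t = t} {f} (horner g c (constant g≈t) f≈xg+c) r =
    (λ _ → t) , constant (λ _ → refl) , λ x → begin
      f x                        ≈⟨ f≈xg+c x ⟩
      x * g x + c                ≈⟨ +-congʳ (*-congˡ (g≈t x)) ⟩
      x * t + c                  ≈⟨ solve 4 (λ x r t c → x :* t :+ c := (x :- r) :* t :+ (r :* t :+ c)) refl x r t c ⟩
      (x - r) * t + (r * t + c)  ≈⟨ +-congˡ (trans (f≈xg+c r) (+-congʳ (*-congˡ (g≈t r)))) ⟨
      (x - r) * t + f r          ∎
  polynomial-division {f = f} (horner g c pg@(horner _ _ _ _) f≈xg+c) r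
    with h , ph , g≈[x-r]h+gr ← polynomial-division pg r =
    (λ x → x * h x + g r) , horner h (g r) ph (λ _ → refl) , λ x → begin
      f x                                      ≈⟨ f≈xg+c x ⟩
      x * g x + c                              ≈⟨ +-congʳ (*-congˡ (g≈[x-r]h+gr x)) ⟩
      x * ((x - r) * h x + g r) + c
        ≈⟨ solve 5 (λ x r h g c → x :* ((x :- r) :* h :+ g) :+ c := (x :- r) :* (x :* h :+ g) :+ (r :* g :+ c))
                   refl x r (h x) (g r) c ⟩
      (x - r) * (x * h x + g r) + (r * g r + c) ≈⟨ +-congˡ (f≈xg+c r) ⟨
      (x - r) * (x * h x + g r) + f r           ∎

  polynomial-roots : ∀ {d t f} → IsPolynomial d t f → (root : Fin (suc d) → Carrier) →
                     (∀ i j → root i ≈ root j → i ≡ j) → (∀ i → f (root i) ≈ 0#) → t ≈ 0#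
  polynomial-roots (constant f≈t) root _ f[root]≈0 = trans (sym (f≈t (root Fin.zero))) (f[root]≈0 Fin.zero)
  polynomial-roots {suc d} {f = f} pf root distinct f[root]≈0
    with h , ph , f≈[x-r]h+fr ← polynomial-division pf (root Fin.zero) =
    polynomial-roots ph (root ∘ Fin.suc) (λ i j eq → Fin.suc-injective (distinct _ _ eq)) h[root]≈0
    where
    r = root Fin.zero
    h[root]≈0 : ∀ i → h (root (Fin.suc i)) ≈ 0#
    h[root]≈0 i = *-cancelˡ y-r≉0 (begin
      (y - r) * h y         ≈⟨ +-identityʳ _ ⟨
      (y - r) * h y + 0#    ≈⟨ +-congˡ (f[root]≈0 Fin.zero) ⟨
      (y - r) * h y + f r   ≈⟨ f≈[x-r]h+fr y ⟨
      f y                   ≈⟨ f[root]≈0 (Fin.suc i) ⟩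
      0#                    ≈⟨ zeroʳ _ ⟨
      (y - r) * 0#          ∎)
      where
      y = root (Fin.suc i)
      y-r≉0 : ¬ y - r ≈ 0#
      y-r≉0 y-r≈0 with () ← distinct (Fin.suc i) Fin.zero
        (trans (sym (//-rightDividesˡ r y)) (trans (+-congʳ y-r≈0) (+-identityˡ r)))

  ∃-x^n≉x : ∀ n → 2 ≤ n → n < size → ∃ λ (x : Carrier) → ¬ x ^ n ≈ x
  ∃-x^n≉x (suc (suc n)) (s≤s (s≤s z≤n)) n<size =
    map enum id (Fin.¬∀⟶∃¬ size _ (λ i → (enum i ^ (2 ℕ.+ n)) ≈? enum i) all-fixed⇒1≈0)
    where
    all-fixed⇒1≈0 : ¬ (∀ i → enum i ^ (2 ℕ.+ n) ≈ enum i)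
    all-fixed⇒1≈0 all-fixed = 1≉0 (polynomial-roots (x^[2+n]-x-polynomial n) (λ i → enum (Fin.inject≤ i n<size))
      (λ i j eq → Fin.inject≤-injective n<size n<size i j (enum-injective eq))
      (λ i → x≈y+z⇒x-z≈y (trans (all-fixed _) (sym (+-identityˡ _)))))

  #-bijection : ∀ {p q} {P : Carrier → Set p} {Q : Carrier → Set q}
                (P? : ∀ x → Dec (P x)) (Q? : ∀ y → Dec (Q y)) →
                P Respects _≈_ → Q Respects _≈_ →
                (φ ψ : Carrier → Carrier) → φ Preserves _≈_ ⟶ _≈_ → ψ Preserves _≈_ ⟶ _≈_ →
                (∀ x → P x → Q (ψ x)) → (∀ y → Q y → P (φ y)) →
                (∀ x → P x → φ (ψ x) ≈ x) → (∀ y → Q y → ψ (φ y) ≈ y) →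
                # P? ≡ # Q?
  #-bijection P? Q? P-resp Q-resp φ ψ φ-cong ψ-cong Pψ Qφ φψ ψφ =
    count-reindex (λ i → P? (enum i)) (λ j → Q? (enum j))
      (λ j → index (φ (enum j))) (λ i → index (ψ (enum i)))
      (λ i Peᵢ → index-resp Q-resp (Pψ _ Peᵢ))
      (λ j Qeⱼ → index-resp P-resp (Qφ _ Qeⱼ))
      (λ i Peᵢ → index≡ (trans (φ-cong (enum-index _)) (φψ _ Peᵢ)))
      (λ j Qeⱼ → index≡ (trans (ψ-cong (enum-index _)) (ψφ _ Qeⱼ)))

  size≡#*# : ∀ {q r} {Q : Carrier → Set q} {R : Carrier → Set r}
             (Q? : ∀ y → Dec (Q y)) (R? : ∀ z → Dec (R z)) →
             Q Respects _≈_ → R Respects _≈_ →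
             (φ : Carrier → Carrier → Carrier) (ψ₁ ψ₂ : Carrier → Carrier) →
             φ Preserves₂ _≈_ ⟶ _≈_ ⟶ _≈_ → ψ₁ Preserves _≈_ ⟶ _≈_ → ψ₂ Preserves _≈_ ⟶ _≈_ →
             (∀ x → Q (ψ₁ x) × R (ψ₂ x)) → (∀ x → φ (ψ₁ x) (ψ₂ x) ≈ x) →
             (∀ y z → Q y → R z → ψ₁ (φ y z) ≈ y × ψ₂ (φ y z) ≈ z) →
             size ≡ # Q? ℕ.* # R?
  size≡#*# Q? R? Q-resp R-resp φ ψ₁ ψ₂ φ-cong ψ₁-cong ψ₂-cong Qψ₁×Rψ₂ φψ ψφ =
    ≡.trans (≡.sym count-all) (≡.trans
      (count-reindex₂ (λ _ → yes tt) (λ j k → Q? (enum j) ×-dec R? (enum k))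
         (λ j k → index (φ (enum j) (enum k))) (λ i → index (ψ₁ (enum i))) (λ i → index (ψ₂ (enum i)))
         (λ i _ → index-resp Q-resp (proj₁ (Qψ₁×Rψ₂ _)) , index-resp R-resp (proj₂ (Qψ₁×Rψ₂ _)))
         (λ _ _ _ → tt)
         (λ i _ → index≡ (trans (φ-cong (enum-index _) (enum-index _)) (φψ _)))
         (λ j k (Qeⱼ , Reₖ) → index≡ (trans (ψ₁-cong (enum-index _)) (proj₁ (ψφ _ _ Qeⱼ Reₖ)))
                            , index≡ (trans (ψ₂-cong (enum-index _)) (proj₂ (ψφ _ _ Qeⱼ Reₖ)))))
      (count₂-× (λ j → Q? (enum j)) (λ k → R? (enum k))))

module TwoCyclePairing {a ℓ} (F : FiniteField a ℓ) (g : FiniteField.Carrier F → FiniteField.Carrier F)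
                       (g-cong : g Preserves FiniteField._≈_ F ⟶ FiniteField._≈_ F) where
  open FiniteField F
  open FiniteFieldTheory F using (#_; index-resp; index≡)
  open Counting
  open ≡.≡-Reasoning

  TwoCyclePoint : Carrier → Set ℓ
  TwoCyclePoint x = g (g x) ≈ x × ¬ g x ≈ x

  twoCyclePoint? : ∀ x → Dec (TwoCyclePoint x)
  twoCyclePoint? x = (g (g x) ≈? x) ×-dec ¬? (g x ≈? x)

  TwoCyclePoint-resp : TwoCyclePoint Respects _≈_
  TwoCyclePoint-resp x≈y (ggx≈x , gx≉x) =
    trans (g-cong (g-cong (sym x≈y))) (trans ggx≈x x≈y) , λ gy≈y → gx≉x (trans (g-cong x≈y) (trans gy≈y (sym x≈y)))

  partner : Fin size → Fin size
  partner i = index (g (enum i))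

  partner-involutive : ∀ i → TwoCyclePoint (enum i) → partner (partner i) ≡ i
  partner-involutive i (ggx≈x , _) = index≡ (trans (g-cong (enum-index _)) ggx≈x)

  partner-twoCyclePoint : ∀ i → TwoCyclePoint (enum i) → TwoCyclePoint (enum (partner i))
  partner-twoCyclePoint i (ggx≈x , gx≉x) =
    index-resp TwoCyclePoint-resp (g-cong ggx≈x , λ ggx≈gx → gx≉x (sym (trans (sym ggx≈x) ggx≈gx)))

  partner≢ : ∀ i → TwoCyclePoint (enum i) → toℕ i ≢ toℕ (partner i)
  partner≢ i (_ , gx≉x) i≡partner =
    gx≉x (trans (sym (enum-index _)) (reflexive (≡.cong enum (≡.sym (Fin.toℕ-injective i≡partner)))))

  -- numTwoCycles counts the point of each two-cycle with the smaller index;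
  -- the other one is a LaterPoint.
  LaterPoint : Fin size → Set ℓ
  LaterPoint i = TwoCyclePoint (enum i) × toℕ (partner i) < toℕ i

  laterPoint? : ∀ i → Dec (LaterPoint i)
  laterPoint? i = twoCyclePoint? (enum i) ×-dec (toℕ (partner i) ℕ.<? toℕ i)

  #twoCyclePoint≡2*numTwoCycles : # twoCyclePoint? ≡ 2 ℕ.* numTwoCycles F g
  #twoCyclePoint≡2*numTwoCycles = begin
    # twoCyclePoint?                  ≡⟨ count-⊎ (twoCyclePoint? ∘ enum) rep? laterPoint? earlier-or-later
                                           (λ i (ggx≈x , gx≉x , _) → ggx≈x , gx≉x) (λ i → proj₁)
                                           (λ i (_ , _ , lift i<j) (_ , j<i) → ℕ.<-asym i<j j<i) ⟩
    count rep? ℕ.+ count laterPoint?  ≡⟨ ≡.cong (count rep? ℕ.+_) #rep≡#laterPoint ⟨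
    count rep? ℕ.+ count rep?         ≡⟨ ≡.cong (count rep? ℕ.+_) (ℕ.+-identityʳ _) ⟨
    2 ℕ.* count rep?                  ≡⟨ ≡.cong (2 ℕ.*_) (length-filter-allFin rep?) ⟨
    2 ℕ.* numTwoCycles F g            ∎
    where
    rep? = isTwoCycleRep? F g
    earlier-or-later : ∀ i → TwoCyclePoint (enum i) → IsTwoCycleRep F g i ⊎ LaterPoint i
    earlier-or-later i x∈S@(ggx≈x , gx≉x) with ℕ.<-cmp (toℕ i) (toℕ (partner i))
    ... | tri< i<j _ _ = inj₁ (ggx≈x , gx≉x , lift i<j)
    ... | tri≈ _ i≡j _ = contradiction i≡j (partner≢ i x∈S)
    ... | tri> _ _ j<i = inj₂ (x∈S , j<i)
    #rep≡#laterPoint : count rep? ≡ count laterPoint?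
    #rep≡#laterPoint = count-reindex rep? laterPoint? partner partner
      (λ i (ggx≈x , gx≉x , lift i<j) → let x∈S = ggx≈x , gx≉x in
         partner-twoCyclePoint i x∈S , ≡.subst (λ k → toℕ k < toℕ (partner i)) (≡.sym (partner-involutive i x∈S)) i<j)
      (λ i (x∈S , j<i) → let ggy≈y , gy≉y = partner-twoCyclePoint i x∈S in
         ggy≈y , gy≉y , lift (≡.subst (λ k → toℕ (partner i) < toℕ k) (≡.sym (partner-involutive i x∈S)) j<i))
      (λ i (ggx≈x , gx≉x , _) → partner-involutive i (ggx≈x , gx≉x))
      (λ i (x∈S , _) → partner-involutive i x∈S)

module Conjugation {a ℓ} (F : FiniteField a ℓ) {p k : ℕ} (pp : Prime p) (p%2≡1 : p % 2 ≡ 1)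
                   (k≥1 : k ≥ 1) (size≡q*q : FiniteField.size F ≡ p ℕ.^ k ℕ.* p ℕ.^ k) where
  open FiniteField F
  open FiniteFieldTheory F
  open IntegerCoefficientSolver commRing using (solve; _:=_; _:+_; _:*_; _:-_; :-_)
  open Counting
  open import Relation.Binary.Reasoning.Setoid setoid
  open import Algebra.Properties.Group +-group using (//-rightDividesˡ; inverseʳ-unique)
  open import Algebra.Properties.Ring ring using (x+x≈x⇒x≈0)
  open import Algebra.Properties.Monoid.Mult +-monoid using (×-congʳ; ×-assocˡ) renaming (_×_ to _·_)

  q : ℕ
  q = p ℕ.^ k

  p·1≈0 : p · 1# ≈ 0#
  p·1≈0 = x^n≈0⇒x≈0 (k ℕ.+ k) (begin
    (p · 1#) ^ (k ℕ.+ k)  ≈⟨ n^j·1≈[n·1]^j p (k ℕ.+ k) ⟨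
    (p ℕ.^ (k ℕ.+ k)) · 1# ≡⟨ ≡.cong (_· 1#) (≡.trans (ℕ.^-distribˡ-+-* p k k) (≡.sym size≡q*q)) ⟩
    size · 1#             ≈⟨ size·x≈0 1# ⟩
    0#                    ∎)

  conj : Carrier → Carrier
  conj x = x ^ q

  conj-cong : ∀ {x y} → x ≈ y → conj x ≈ conj y
  conj-cong = ^-congˡ q

  conj-+ : ∀ x y → conj (x + y) ≈ conj x + conj y
  conj-+ = frobenius^ pp p·1≈0 k

  conj-* : ∀ x y → conj (x * y) ≈ conj x * conj y
  conj-* x y = ^-distrib-* x y q

  conj-1 : conj 1# ≈ 1#
  conj-1 = 1^n≈1 q

  conj-0 : conj 0# ≈ 0#
  conj-0 = x+x≈x⇒x≈0 (conj 0#) (trans (sym (conj-+ 0# 0#)) (conj-cong (+-identityˡ 0#)))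

  conj-neg : ∀ x → conj (- x) ≈ - conj x
  conj-neg x = inverseʳ-unique (conj x) (conj (- x))
    (trans (sym (conj-+ x (- x))) (trans (conj-cong (-‿inverseʳ x)) conj-0))

  conj-sub : ∀ x y → conj (x - y) ≈ conj x - conj y
  conj-sub x y = trans (conj-+ x (- y)) (+-congˡ (conj-neg y))

  conj-involutive : ∀ x → conj (conj x) ≈ x
  conj-involutive x = begin
    (x ^ q) ^ q      ≈⟨ ^-assocʳ x q q ⟨
    x ^ (q ℕ.* q)    ≡⟨ ≡.cong (x ^_) size≡q*q ⟨
    x ^ size         ≈⟨ x^size≈x x ⟩
    x                ∎

  conj-⁻¹ : ∀ x → conj (x ⁻¹) ≈ (conj x) ⁻¹
  conj-⁻¹ x = cases (x ≈? 0#)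
    where
    cases : Dec (x ≈ 0#) → conj (x ⁻¹) ≈ (conj x) ⁻¹
    cases (yes x≈0) = trans (conj-cong (x≈0⇒x⁻¹≈0 x≈0))
                        (trans conj-0 (sym (x≈0⇒x⁻¹≈0 (trans (conj-cong x≈0) conj-0))))
    cases (no x≉0)  = x*y≈1⇒y≈x⁻¹ (trans (sym (conj-* x (x ⁻¹))) (trans (conj-cong (x*x⁻¹≈1 x≉0)) conj-1))

  -- As for ℂ over ℝ: the real elements form 𝔽_q, the imaginary ones are
  -- those with x + conj x ≈ 0.
  Real Imaginary NonzeroImaginary : Carrier → Set ℓ
  Real x = conj x ≈ x
  Imaginary x = conj x ≈ - x
  NonzeroImaginary x = Imaginary x × ¬ x ≈ 0#

  real? : ∀ x → Dec (Real x)
  real? x = conj x ≈? x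

  imaginary? : ∀ x → Dec (Imaginary x)
  imaginary? x = conj x ≈? (- x)

  nonzeroImaginary? : ∀ x → Dec (NonzeroImaginary x)
  nonzeroImaginary? x = imaginary? x ×-dec ¬? (x ≈? 0#)

  Real-resp : Real Respects _≈_
  Real-resp x≈y conj-x≈x = trans (conj-cong (sym x≈y)) (trans conj-x≈x x≈y)

  Imaginary-resp : Imaginary Respects _≈_
  Imaginary-resp x≈y conj-x≈-x = trans (conj-cong (sym x≈y)) (trans conj-x≈-x (-‿cong x≈y))

  NonzeroImaginary-resp : NonzeroImaginary Respects _≈_
  NonzeroImaginary-resp x≈y (x̄≈-x , x≉0) = Imaginary-resp x≈y x̄≈-x , λ y≈0 → x≉0 (trans x≈y y≈0)

  real-part-real : ∀ x → Real (x + conj x)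
  real-part-real x = trans (conj-+ x (conj x)) (trans (+-congˡ (conj-involutive x)) (+-comm _ _))

  imaginary-part-imaginary : ∀ x → Imaginary (x - conj x)
  imaginary-part-imaginary x = trans (conj-sub x (conj x)) (trans (+-congˡ (-‿cong (conj-involutive x)))
    (solve 2 (λ x x̄ → x̄ :- x := :- (x :- x̄)) refl x (conj x)))

  real*imaginary : ∀ {a v} → Real a → Imaginary v → Imaginary (a * v)
  real*imaginary {a} {v} ā≈a v̄≈-v = trans (conj-* a v) (trans (*-cong ā≈a v̄≈-v)
    (solve 2 (λ a v → a :* (:- v) := :- (a :* v)) refl a v))

  imaginary*imaginary : ∀ {u v} → Imaginary u → Imaginary v → Real (u * v)
  imaginary*imaginary {u} {v} ū≈-u v̄≈-v = trans (conj-* u v) (trans (*-cong ū≈-u v̄≈-v)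
    (solve 2 (λ u v → (:- u) :* (:- v) := u :* v) refl u v))

  two : Carrier
  two = 1# + 1#

  -- p = 1 + 2h, so 2 ≈ 0 would give 0 ≈ p · 1 ≈ 1.
  two≉0 : ¬ two ≈ 0#
  two≉0 two≈0 = 1≉0 (begin
    1#                    ≈⟨ +-identityʳ 1# ⟨
    1# + 0#               ≈⟨ +-congˡ (n·0≈0 h) ⟨
    1# + h · 0#           ≈⟨ +-congˡ (×-congʳ h (trans (+-congˡ (+-identityʳ 1#)) two≈0)) ⟨
    1# + h · (2 · 1#)     ≈⟨ +-congˡ (×-assocˡ 1# h 2) ⟩
    (1 ℕ.+ h ℕ.* 2) · 1#  ≡⟨ ≡.cong (_· 1#) p≡1+h*2 ⟨
    p · 1#                ≈⟨ p·1≈0 ⟩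
    0#                    ∎)
    where
    h = p / 2
    p≡1+h*2 : p ≡ 1 ℕ.+ h ℕ.* 2
    p≡1+h*2 = ≡.trans (m≡m%n+[m/n]*n p 2) (≡.cong (ℕ._+ h ℕ.* 2) p%2≡1)

  ½ : Carrier
  ½ = two ⁻¹

  [x+x]*½≈x : ∀ x → (x + x) * ½ ≈ x
  [x+x]*½≈x x = begin
    (x + x) * ½               ≈⟨ *-congʳ (+-cong (*-identityʳ x) (*-identityʳ x)) ⟨
    (x * 1# + x * 1#) * ½     ≈⟨ *-congʳ (distribˡ x 1# 1#) ⟨
    (x * two) * ½             ≈⟨ *-assoc x two ½ ⟩
    x * (two * ½)             ≈⟨ *-congˡ (x*x⁻¹≈1 two≉0) ⟩
    x * 1#                    ≈⟨ *-identityʳ x ⟩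
    x                         ∎

  conj-½ : conj ½ ≈ ½
  conj-½ = trans (conj-⁻¹ two) (⁻¹-cong (trans (conj-+ 1# 1#) (+-cong conj-1 conj-1)))

  [[x+x̄]+[x-x̄]]*½≈x : ∀ x → ((x + conj x) + (x - conj x)) * ½ ≈ x
  [[x+x̄]+[x-x̄]]*½≈x x = trans (*-congʳ (solve 2 (λ x x̄ → (x :+ x̄) :+ (x :- x̄) := x :+ x) refl x (conj x)))
                                ([x+x]*½≈x x)

  ½[a+v]-parts : ∀ {a v} → Real a → Imaginary v →
                 (a + v) * ½ + conj ((a + v) * ½) ≈ a × (a + v) * ½ - conj ((a + v) * ½) ≈ v
  ½[a+v]-parts {a} {v} ā≈a v̄≈-v =
    trans (+-congˡ conj-y)
      (trans (solve 3 (λ a v h → (a :+ v) :* h :+ (a :- v) :* h := (a :+ a) :* h) refl a v ½) ([x+x]*½≈x a)) ,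
    trans (+-congˡ (-‿cong conj-y))
      (trans (solve 3 (λ a v h → (a :+ v) :* h :- (a :- v) :* h := (v :+ v) :* h) refl a v ½) ([x+x]*½≈x v))
    where
    conj-y : conj ((a + v) * ½) ≈ (a - v) * ½
    conj-y = trans (conj-* _ _) (*-cong (trans (conj-+ a v) (+-cong ā≈a v̄≈-v)) conj-½)

  q≥2 : 2 ≤ q
  q≥2 = ℕ.≤-trans (prime≥2 pp) (ℕ.≤-trans (ℕ.≤-reflexive (≡.sym (ℕ.*-identityʳ p)))
                                         (ℕ.^-monoʳ-≤ p {{prime⇒nonZero pp}} k≥1))

  q<size : q < size
  q<size = ℕ.<-≤-trans (ℕ.m<m*n q q {{ℕ.>-nonZero (ℕ.<-trans ℕ.0<1+n q≥2)}} q≥2) (ℕ.≤-reflexive (≡.sym size≡q*q))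

  -- x ^ q - x has at most q < q * q roots.
  nonreal : ∃ λ e → ¬ conj e ≈ e
  nonreal = ∃-x^n≉x q q≥2 q<size

  d : Carrier
  d = proj₁ nonreal - conj (proj₁ nonreal)

  d≉0 : ¬ d ≈ 0#
  d≉0 d≈0 = proj₂ nonreal (sym (trans (sym (//-rightDividesˡ (conj e) e)) (trans (+-congʳ d≈0) (+-identityˡ _))))
    where e = proj₁ nonreal

  d-imaginary : Imaginary d
  d-imaginary = imaginary-part-imaginary (proj₁ nonreal)

  d⁻¹-imaginary : Imaginary (d ⁻¹)
  d⁻¹-imaginary = trans (conj-⁻¹ d) (trans (⁻¹-cong d-imaginary)
    (sym (x*y≈1⇒y≈x⁻¹ (trans (solve 2 (λ d e → (:- d) :* (:- e) := d :* e) refl d (d ⁻¹)) (x*x⁻¹≈1 d≉0)))))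

  d*d⁻¹≈1 : d * d ⁻¹ ≈ 1#
  d*d⁻¹≈1 = x*x⁻¹≈1 d≉0

  -- x = (a + b d) / 2 with a = x + conj x and b = (x - conj x) / d real.
  size≡#real*#real : size ≡ # real? ℕ.* # real?
  size≡#real*#real = size≡#*# real? real? Real-resp Real-resp
    (λ a b → (a + b * d) * ½) (λ x → x + conj x) (λ x → (x - conj x) * d ⁻¹)
    (λ a≈a′ b≈b′ → *-congʳ (+-cong a≈a′ (*-congʳ b≈b′)))
    (λ x≈y → +-cong x≈y (conj-cong x≈y))
    (λ x≈y → *-congʳ (+-cong x≈y (-‿cong (conj-cong x≈y))))
    (λ x → real-part-real x , imaginary*imaginary (imaginary-part-imaginary x) d⁻¹-imaginary)
    decompose
    (λ a b ā≈a b̄≈b → let a≈ , bd≈ = ½[a+v]-parts ā≈a (real*imaginary b̄≈b d-imaginary) in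
      a≈ , trans (*-congʳ bd≈) (trans (*-assoc b d (d ⁻¹)) (trans (*-congˡ d*d⁻¹≈1) (*-identityʳ b))))
    where
    decompose : ∀ x → ((x + conj x) + ((x - conj x) * d ⁻¹) * d) * ½ ≈ x
    decompose x = trans (*-congʳ (+-congˡ (trans (*-assoc _ _ _)
                    (trans (*-congˡ (trans (*-comm _ _) d*d⁻¹≈1)) (*-identityʳ _)))))
                  ([[x+x̄]+[x-x̄]]*½≈x x)

  #real≡q : # real? ≡ q
  #real≡q = m*m≡n*n⇒m≡n (≡.trans (≡.sym size≡#real*#real) size≡q*q)
    where
    m*m≡n*n⇒m≡n : ∀ {m n} → m ℕ.* m ≡ n ℕ.* n → m ≡ n
    m*m≡n*n⇒m≡n {m} {n} m*m≡n*n with ℕ.<-cmp m n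
    ... | tri< m<n _ _ = contradiction m*m≡n*n (ℕ.<⇒≢ (ℕ.*-mono-< m<n m<n))
    ... | tri≈ _ m≡n _ = m≡n
    ... | tri> _ _ n<m = contradiction (≡.sym m*m≡n*n) (ℕ.<⇒≢ (ℕ.*-mono-< n<m n<m))

  #imaginary≡#real : # imaginary? ≡ # real?
  #imaginary≡#real = #-bijection imaginary? real? Imaginary-resp Real-resp
    (_* d) (_* d ⁻¹) *-congʳ *-congʳ
    (λ v v̄≈-v → imaginary*imaginary v̄≈-v d⁻¹-imaginary)
    (λ a ā≈a → real*imaginary ā≈a d-imaginary)
    (λ v _ → cancel v (trans (*-comm _ _) d*d⁻¹≈1))
    (λ a _ → cancel a d*d⁻¹≈1)
    where
    cancel : ∀ x {u w} → u * w ≈ 1# → x * u * w ≈ x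
    cancel x uw≈1 = trans (*-assoc _ _ _) (trans (*-congˡ uw≈1) (*-identityʳ x))

  #imaginary≡#nonzeroImaginary+1 : # imaginary? ≡ # nonzeroImaginary? ℕ.+ 1
  #imaginary≡#nonzeroImaginary+1 = ≡.trans
    (count-⊎ (imaginary? ∘ enum) (nonzeroImaginary? ∘ enum) (Fin._≟ index 0#)
      (λ i v̄≈-v → case (enum i ≈? 0#) of λ where
         (yes eᵢ≈0) → inj₂ (≡.sym (index≡ (sym eᵢ≈0)))
         (no eᵢ≉0)  → inj₁ (v̄≈-v , eᵢ≉0))
      (λ i → proj₁)
      (λ { i ≡.refl → Imaginary-resp (sym (enum-index 0#)) 0-imaginary })
      (λ { i (_ , eᵢ≉0) ≡.refl → eᵢ≉0 (enum-index 0#) }))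
    (≡.cong (# nonzeroImaginary? ℕ.+_) (count-≡ (index 0#)))
    where
    0-imaginary : Imaginary 0#
    0-imaginary = trans conj-0 (sym (trans (sym (+-identityˡ (- 0#))) (-‿inverseʳ 0#)))

  #nonzeroImaginary≡q∸1 : # nonzeroImaginary? ≡ q ℕ.∸ 1
  #nonzeroImaginary≡q∸1 = ≡.trans (≡.sym (ℕ.m+n∸n≡m _ 1)) (≡.cong (ℕ._∸ 1)
    (≡.trans (≡.sym #imaginary≡#nonzeroImaginary+1) (≡.trans #imaginary≡#real #real≡q)))

module TwoCycles {a ℓ} (F : FiniteField a ℓ) {p k : ℕ} (pp : Prime p) (p%2≡1 : p % 2 ≡ 1)
                 (k≥1 : k ≥ 1) (size≡q*q : FiniteField.size F ≡ p ℕ.^ k ℕ.* p ℕ.^ k)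
                 (c : FiniteField.Carrier F) (c^q≈c : FiniteField._≈_ F (FiniteField._^_ F c (p ℕ.^ k)) c)
                 (c≉0 : ¬ FiniteField._≈_ F c (FiniteField.0# F)) where
  open FiniteField F
  open FiniteFieldTheory F
  open Conjugation F pp p%2≡1 k≥1 size≡q*q
  open IntegerCoefficientSolver commRing using (solve; _:=_; _:+_; _:*_; _:-_; :-_)
  open import Relation.Binary.Reasoning.Setoid setoid
  open import Algebra.Properties.Group +-group using () renaming (⁻¹-involutive to -‿involutive)

  f : Carrier → Carrier
  f x = c * (x ^ (q ℕ.+ 1) - x ^ 2)

  f-cong : ∀ {x y} → x ≈ y → f x ≈ f y
  f-cong x≈y = *-congˡ (+-cong (^-congˡ (q ℕ.+ 1) x≈y) (-‿cong (^-congˡ 2 x≈y)))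

  open TwoCyclePairing F f f-cong

  f≈cx[x̄-x] : ∀ x → f x ≈ c * x * (conj x - x)
  f≈cx[x̄-x] x = begin
    c * (x ^ (q ℕ.+ 1) - x ^ 2)   ≈⟨ *-congˡ (+-cong (trans (^-homo-* x q 1) (*-congˡ (*-identityʳ x)))
                                                       (-‿cong (*-congˡ (*-identityʳ x)))) ⟩
    c * (conj x * x - x * x)
      ≈⟨ solve 3 (λ c x x̄ → c :* (x̄ :* x :- x :* x) := c :* x :* (x̄ :- x)) refl c x (conj x) ⟩
    c * x * (conj x - x)          ∎

  conj-f : ∀ x → conj (f x) ≈ c * conj x * (x - conj x)
  conj-f x = begin
    conj (f x)                              ≈⟨ conj-cong (f≈cx[x̄-x] x) ⟩
    conj (c * x * (conj x - x))             ≈⟨ conj-* _ _ ⟩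
    conj (c * x) * conj (conj x - x)        ≈⟨ *-cong (conj-* c x) (conj-sub (conj x) x) ⟩
    conj c * conj x * (conj (conj x) - conj x) ≈⟨ *-cong (*-congʳ c^q≈c) (+-congʳ (conj-involutive x)) ⟩
    c * conj x * (x - conj x)               ∎

  c³ : Carrier
  c³ = c * c * c

  c³≉0 : ¬ c³ ≈ 0#
  c³≉0 = *-nonzero (*-nonzero c≉0 c≉0) c≉0

  μ : Carrier → Carrier
  μ x = - c³ * (x + conj x) * ((x - conj x) * (x - conj x))

  f∘f≈μ* : ∀ x → f (f x) ≈ μ x * x
  f∘f≈μ* x = begin
    f (f x)                                 ≈⟨ f≈cx[x̄-x] (f x) ⟩
    c * f x * (conj (f x) - f x)
      ≈⟨ *-cong (*-congˡ (f≈cx[x̄-x] x)) (+-cong (conj-f x) (-‿cong (f≈cx[x̄-x] x))) ⟩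
    c * (c * x * (conj x - x)) * (c * conj x * (x - conj x) - c * x * (conj x - x))
      ≈⟨ solve 3 (λ c x x̄ → c :* (c :* x :* (x̄ :- x)) :* (c :* x̄ :* (x :- x̄) :- c :* x :* (x̄ :- x))
                        := :- (c :* c :* c) :* (x :+ x̄) :* ((x :- x̄) :* (x :- x̄)) :* x) refl c x (conj x) ⟩
    μ x * x                                 ∎

  -- c (x̄ - x) ≈ 1 and its conjugate c (x - x̄) ≈ 1 would add up to 2 ≈ 0.
  f-fixed⇒≈0 : ∀ {x} → f x ≈ x → x ≈ 0#
  f-fixed⇒≈0 {x} fx≈x with x ≈? 0#
  ... | yes x≈0 = x≈0
  ... | no x≉0  = contradiction (begin
    two                                  ≈⟨ +-cong c[x̄-x]≈1 c[x-x̄]≈1 ⟨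
    c * (conj x - x) + c * (x - conj x)
      ≈⟨ solve 3 (λ c x x̄ → c :* (x̄ :- x) :+ c :* (x :- x̄) := x :- x) refl c x (conj x) ⟩
    x - x                                ≈⟨ -‿inverseʳ x ⟩
    0#                                   ∎) two≉0
    where
    c[x̄-x]≈1 : c * (conj x - x) ≈ 1#
    c[x̄-x]≈1 = *-cancelˡ x≉0 (begin
      x * (c * (conj x - x))  ≈⟨ solve 3 (λ c x x̄ → x :* (c :* (x̄ :- x)) := c :* x :* (x̄ :- x)) refl c x (conj x) ⟩
      c * x * (conj x - x)    ≈⟨ f≈cx[x̄-x] x ⟨
      f x                     ≈⟨ fx≈x ⟩
      x                       ≈⟨ *-identityʳ x ⟨
      x * 1#                  ∎)
    c[x-x̄]≈1 : c * (x - conj x) ≈ 1#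
    c[x-x̄]≈1 = begin
      c * (x - conj x)                 ≈⟨ *-cong c^q≈c (+-congʳ (conj-involutive x)) ⟨
      conj c * (conj (conj x) - conj x) ≈⟨ *-congˡ (conj-sub (conj x) x) ⟨
      conj c * conj (conj x - x)       ≈⟨ conj-* c (conj x - x) ⟨
      conj (c * (conj x - x))          ≈⟨ conj-cong c[x̄-x]≈1 ⟩
      conj 1#                          ≈⟨ conj-1 ⟩
      1#                               ∎

  twoCyclePoint⇒≉0×μ≈1 : ∀ {x} → TwoCyclePoint x → ¬ x ≈ 0# × μ x ≈ 1#
  twoCyclePoint⇒≉0×μ≈1 {x} (ffx≈x , fx≉x) = x≉0 , *-cancelˡ x≉0 (begin
    x * μ x   ≈⟨ *-comm x (μ x) ⟩
    μ x * x   ≈⟨ f∘f≈μ* x ⟨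
    f (f x)   ≈⟨ ffx≈x ⟩
    x         ≈⟨ *-identityʳ x ⟨
    x * 1#    ∎)
    where
    x≉0 : ¬ x ≈ 0#
    x≉0 x≈0 = fx≉x (trans (trans (f≈cx[x̄-x] x) (trans (*-congʳ (trans (*-congˡ x≈0) (zeroʳ c))) (zeroˡ _)))
                          (sym x≈0))

  ≉0×μ≈1⇒twoCyclePoint : ∀ {x} → ¬ x ≈ 0# → μ x ≈ 1# → TwoCyclePoint x
  ≉0×μ≈1⇒twoCyclePoint {x} x≉0 μx≈1 =
    trans (f∘f≈μ* x) (trans (*-congʳ μx≈1) (*-identityˡ x)) , λ fx≈x → x≉0 (f-fixed⇒≈0 fx≈x)

  -- The value of x + conj x forced at a two-cycle point x with x - conj x = v.
  u : Carrier → Carrier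
  u v = - (c³ * (v * v)) ⁻¹

  u-real : ∀ {v} → Imaginary v → Real (u v)
  u-real {v} v̄≈-v = trans (conj-neg _) (-‿cong (trans (conj-⁻¹ _) (⁻¹-cong (trans (conj-* c³ (v * v))
    (*-cong c³-real (imaginary*imaginary v̄≈-v v̄≈-v))))))
    where
    c³-real : Real c³
    c³-real = trans (conj-* (c * c) c) (*-cong (trans (conj-* c c) (*-cong c^q≈c c^q≈c)) c^q≈c)

  μ≈1⇒x+x̄≈u[x-x̄] : ∀ {x} → μ x ≈ 1# → x + conj x ≈ u (x - conj x)
  μ≈1⇒x+x̄≈u[x-x̄] {x} μx≈1 = begin
    x + conj x          ≈⟨ -‿involutive (x + conj x) ⟨
    - (- (x + conj x))  ≈⟨ -‿cong (x*y≈1⇒y≈x⁻¹ (trans c³v²*[-s]≈μ μx≈1)) ⟩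
    u (x - conj x)      ∎
    where
    c³v²*[-s]≈μ : c³ * ((x - conj x) * (x - conj x)) * - (x + conj x) ≈ μ x
    c³v²*[-s]≈μ = solve 3 (λ C s v² → (C :* v²) :* (:- s) := :- C :* s :* v²)
                          refl c³ (x + conj x) ((x - conj x) * (x - conj x))

  twoCyclePoint⇒nonzeroImaginary : ∀ {x} → TwoCyclePoint x → NonzeroImaginary (x - conj x)
  twoCyclePoint⇒nonzeroImaginary {x} x∈S = imaginary-part-imaginary x , λ x-x̄≈0 → 1≉0 (begin
    1#                                                  ≈⟨ proj₂ (twoCyclePoint⇒≉0×μ≈1 x∈S) ⟨
    - c³ * (x + conj x) * ((x - conj x) * (x - conj x)) ≈⟨ *-congˡ (trans (*-congʳ x-x̄≈0) (zeroˡ _)) ⟩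
    - c³ * (x + conj x) * 0#                            ≈⟨ zeroʳ _ ⟩
    0#                                                  ∎)

  pointOver : Carrier → Carrier
  pointOver v = (u v + v) * ½

  pointOver-cong : ∀ {v w} → v ≈ w → pointOver v ≈ pointOver w
  pointOver-cong v≈w = *-congʳ (+-cong (-‿cong (⁻¹-cong (*-congˡ (*-cong v≈w v≈w)))) v≈w)

  pointOver-imaginaryPart : ∀ {v} → Imaginary v → pointOver v - conj (pointOver v) ≈ v
  pointOver-imaginaryPart v̄≈-v = proj₂ (½[a+v]-parts (u-real v̄≈-v) v̄≈-v)

  pointOver-twoCyclePoint : ∀ {v} → NonzeroImaginary v → TwoCyclePoint (pointOver v)
  pointOver-twoCyclePoint {v} (v̄≈-v , v≉0) = ≉0×μ≈1⇒twoCyclePoint y≉0 (begin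
    - c³ * (y + conj y) * ((y - conj y) * (y - conj y))
      ≈⟨ *-cong (*-congˡ (proj₁ (½[a+v]-parts (u-real v̄≈-v) v̄≈-v))) (*-cong y-ȳ≈v y-ȳ≈v) ⟩
    - c³ * u v * (v * v)
      ≈⟨ solve 3 (λ C e w → :- C :* (:- e) :* w := (C :* w) :* e) refl c³ ((c³ * (v * v)) ⁻¹) (v * v) ⟩
    (c³ * (v * v)) * (c³ * (v * v)) ⁻¹  ≈⟨ x*x⁻¹≈1 (*-nonzero c³≉0 (*-nonzero v≉0 v≉0)) ⟩
    1#                                  ∎)
    where
    y = pointOver v
    y-ȳ≈v = pointOver-imaginaryPart v̄≈-v
    y≉0 : ¬ y ≈ 0#
    y≉0 y≈0 = v≉0 (begin
      v           ≈⟨ y-ȳ≈v ⟨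
      y - conj y  ≈⟨ +-cong y≈0 (-‿cong (trans (conj-cong y≈0) conj-0)) ⟩
      0# - 0#     ≈⟨ -‿inverseʳ 0# ⟩
      0#          ∎)

  pointOver[x-x̄]≈x : ∀ {x} → TwoCyclePoint x → pointOver (x - conj x) ≈ x
  pointOver[x-x̄]≈x {x} x∈S = begin
    (u (x - conj x) + (x - conj x)) * ½  ≈⟨ *-congʳ (+-congʳ (μ≈1⇒x+x̄≈u[x-x̄] (proj₂ (twoCyclePoint⇒≉0×μ≈1 x∈S)))) ⟨
    ((x + conj x) + (x - conj x)) * ½    ≈⟨ [[x+x̄]+[x-x̄]]*½≈x x ⟩
    x                                    ∎

  #twoCyclePoint≡#nonzeroImaginary : # twoCyclePoint? ≡ # nonzeroImaginary?
  #twoCyclePoint≡#nonzeroImaginary = #-bijection twoCyclePoint? nonzeroImaginary?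
    TwoCyclePoint-resp NonzeroImaginary-resp pointOver (λ x → x - conj x)
    pointOver-cong (λ x≈y → +-cong x≈y (-‿cong (conj-cong x≈y)))
    (λ _ → twoCyclePoint⇒nonzeroImaginary) (λ _ → pointOver-twoCyclePoint)
    (λ _ → pointOver[x-x̄]≈x) (λ _ → pointOver-imaginaryPart ∘ proj₁)

  numTwoCycles≡[q∸1]/2 : numTwoCycles F f ≡ (q ℕ.∸ 1) / 2
  numTwoCycles≡[q∸1]/2 = ≡.sym (≡.trans (≡.cong (_/ 2) (≡.sym 2*numTwoCycles≡q∸1)) (m*n/n≡m (numTwoCycles F f) 2))
    where
    2*numTwoCycles≡q∸1 : numTwoCycles F f ℕ.* 2 ≡ q ℕ.∸ 1
    2*numTwoCycles≡q∸1 = ≡.trans (ℕ.*-comm (numTwoCycles F f) 2) (≡.trans (≡.sym #twoCyclePoint≡2*numTwoCycles)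
      (≡.trans #twoCyclePoint≡#nonzeroImaginary #nonzeroImaginary≡q∸1))

open import Data.Nat using (_^_; _+_)

corollary2p10 : ∀ {a ℓ : Level} (p k : ℕ) → Prime p → p % 2 ≡ 1 → k ≥ 1 →
    (F : FiniteField a ℓ) → FiniteField.size F ≡ (p ^ k) ^ 2 →
    (c : FiniteField.Carrier F) →
    FiniteField._≈_ F (FiniteField._^_ F c (p ^ k)) c →
    ¬ (FiniteField._≈_ F c (FiniteField.0# F)) →
    numTwoCycles F
      (λ x → FiniteField._*_ F c
        (FiniteField._-_ F (FiniteField._^_ F x (p ^ k + 1))
                           (FiniteField._^_ F x 2)))
      ≡ (p ^ k ∸ 1) / 2
corollary2p10 p k pp p%2≡1 k≥1 F size≡q² c c^q≈c c≉0 =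
  TwoCycles.numTwoCycles≡[q∸1]/2 F pp p%2≡1 k≥1 size≡q*q c c^q≈c c≉0
  where
  size≡q*q : FiniteField.size F ≡ p ^ k ℕ.* p ^ k
  size≡q*q = ≡.trans size≡q² (≡.cong (p ^ k ℕ.*_) (ℕ.*-identityʳ (p ^ k)))
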